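{- The Vandermonde determinant $a_{\delta_n}=\prod_{1\leq i<j\leq n}(x_i-x_j)\in\mathbb{Z}[x_1,\ldots,x_n]$ has saturated Newton polytope if and only if $n\leq 2$.
   Context: For a polynomial $h=\sum c_\alpha x^\alpha$, its Newton polytope is $\mathrm{conv}\{\alpha:c_\alpha\neq0\}$, and $h$ has saturated Newton polytope if every lattice point of its Newton polytope is an exponent vector $\alpha$ with $c_\alpha\neq0$. -}

module Defs where

open import Data.Nat as ℕ using (ℕ; zero; suc; _<?_)
open import Data.Integer as ℤ using (ℤ; +_; -[1+_])
open import Data.Rational as ℚ using (ℚ; 0ℚ; 1ℚ; _/_)
open import Data.Fin using (Fin; toℕ)
open import Data.Vec as Vec using (Vec; tabulate; zipWith; replicate)
open import Data.Vec.Properties using (≡-dec)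
open import Data.List as List using (List; []; _∷_; allFin; concatMap; filter; foldr)
open import Data.Product using (_×_; _,_; Σ; ∃; ∃-syntax; proj₁; proj₂)
open import Data.List.Relation.Unary.All using (All)
open import Relation.Nullary using (¬_; yes; no)
open import Relation.Binary.PropositionalEquality using (_≡_; _≢_)

-- Multivariate polynomials over ℤ in n variables, represented as formal
-- (finite) sums of terms  c · x^α  (coefficient, exponent vector).
Exp : ℕ → Set
Exp n = Vec ℕ n

Poly : ℕ → Set
Poly n = List (ℤ × Exp n)

coeff : ∀ {n} → Poly n → Exp n → ℤ
coeff [] α = + 0
coeff ((c , β) ∷ p) α with ≡-dec ℕ._≟_ β α
... | yes _ = c ℤ.+ coeff p α
... | no  _ = coeff p α

_*ₚ_ : ∀ {n} → Poly n → Poly n → Poly n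
p *ₚ q = concatMap (λ { (c , α) → List.map (λ { (d , β) → (c ℤ.* d , zipWith ℕ._+_ α β) }) q }) p

oneₚ : ∀ {n} → Poly n
oneₚ = (+ 1 , replicate _ 0) ∷ []

productₚ : ∀ {n} → List (Poly n) → Poly n
productₚ = foldr _*ₚ_ oneₚ

unitExp : ∀ {n} → Fin n → Exp n
unitExp i = tabulate (λ k → if-eq k)
  where
  if-eq : _ → ℕ
  if-eq k with Data.Fin._≟_ k i
  ... | yes _ = 1
  ... | no  _ = 0

var : ∀ {n} → Fin n → Poly n
var i = (+ 1 , unitExp i) ∷ []

diffₚ : ∀ {n} → Fin n → Fin n → Poly n
diffₚ i j = (+ 1 , unitExp i) ∷ (-[1+ 0 ] , unitExp j) ∷ []

pairsLt : (n : ℕ) → List (Fin n × Fin n)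
pairsLt n = filter (λ { (i , j) → toℕ i <? toℕ j })
                   (concatMap (λ i → List.map (λ j → (i , j)) (allFin n)) (allFin n))

vandermonde : (n : ℕ) → Poly n
vandermonde n = productₚ (List.map (λ { (i , j) → diffₚ i j }) (pairsLt n))

InSupport : ∀ {n} → Poly n → Exp n → Set
InSupport p α = coeff p α ≢ + 0

ℕtoℚ : ℕ → ℚ
ℕtoℚ k = (+ k) / 1

ℤtoℚ : ℤ → ℚ
ℤtoℚ z = z / 1

-- a point of ℚ^n lies in the Newton polytope (convex hull of the support)
-- iff it is a convex combination (nonnegative rational weights summing to 1)
-- of finitely many exponent vectors in the support.
InNewtonPolytope : ∀ {n} → Poly n → Vec ℚ n → Set
InNewtonPolytope {n} p v =
  Σ (List (ℚ × Exp n)) λ ws → (All (λ { (λw , α) → (0ℚ ℚ.≤ λw) × InSupport p α }) ws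
          × foldr (λ { (λw , _) s → λw ℚ.+ s }) 0ℚ ws ≡ 1ℚ
          × foldr (λ { (λw , α) s → zipWith ℚ._+_ (Vec.map (λ a → λw ℚ.* ℕtoℚ a) α) s })
                  (replicate n 0ℚ) ws ≡ v)

SaturatedNewton : ∀ {n} → Poly n → Set
SaturatedNewton {n} p =
  (β : Vec ℤ n) → InNewtonPolytope p (Vec.map ℤtoℚ β) →
  ∃[ α ] (Vec.map +_ α ≡ β × InSupport p α)

-- The Vandermonde polynomial is homogeneous of degree n(n-1)/2, so every lattice point of
-- its Newton polytope is a nonnegative integer vector of that degree; for n ≤ 2 every such
-- vector is an exponent of a_δn.  For n ≥ 3, write a_δ(m+1) = ∏_j (x₀ - x_{j+1}) · a_δm(x₁, …, x_m):
-- x₀ occurs with degree at most m, and the coefficient of x₀^m is a_δm.  Iterating reduces the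
-- coefficients at exponents with the staircase prefix (n-1, …, 3) to those of a_δ3, where
-- the exponent (1,1,1) has coefficient 0 although it is the average of (2,1,0), (0,2,1) and
-- (1,0,2), which occur with coefficient 1.
module Submission where

open import Defs
open import Algebra.Bundles using (CommutativeMonoid)
open import Data.Bool using (true; false; if_then_else_)
open import Data.Nat as ℕ using (ℕ; zero; suc; z≤n; s≤s; _≤_; _<?_)
import Data.Nat.Properties as ℕP
open import Data.Integer as ℤ using (ℤ; +_; -[1+_])
import Data.Integer.Properties as ℤP
open import Data.Fin as F using (Fin; zero; suc; toℕ)
open import Data.Vec as Vec using (Vec; _∷_; []; lookup; replicate; zipWith)
import Data.Vec.Properties as VP
open import Data.List as List using (List; []; _∷_; _++_; allFin; foldr; filter; concatMap; length)
import Data.List.Properties as LP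
open import Data.List.Relation.Unary.All as All using (All; []; _∷_)
import Data.List.Relation.Unary.All.Properties as AllP
open import Data.Product as Product using (_×_; _,_; ∃-syntax; proj₁; proj₂)
open import Data.Rational as ℚ using (ℚ; 0ℚ; 1ℚ; mkℚ; ↥_)
import Data.Rational.Properties as ℚP
import Data.Nat.Coprimality as Coprimality
open import Data.Vec.Relation.Unary.All as VAll using ()
import Data.Vec.Relation.Unary.All.Properties as VAllP
open import Data.Empty using (⊥-elim)
open import Function using (_∘_; _∋_)
open import Function.Bundles using (_⇔_; mk⇔)
open import Relation.Nullary using (¬_; Dec; yes; no; does)
open import Relation.Unary using (Decidable)
open import Relation.Binary.PropositionalEquality

coeff-∷-≡ : ∀ {n} c {β α : Exp n} p → β ≡ α → coeff ((c , β) ∷ p) α ≡ c ℤ.+ coeff p α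
coeff-∷-≡ c {β} {α} p β≡α with VP.≡-dec ℕ._≟_ β α
... | yes _   = refl
... | no  β≢α = ⊥-elim (β≢α β≡α)

coeff-∷-≢ : ∀ {n} c {β α : Exp n} p → β ≢ α → coeff ((c , β) ∷ p) α ≡ coeff p α
coeff-∷-≢ c {β} {α} p β≢α with VP.≡-dec ℕ._≟_ β α
... | yes β≡α = ⊥-elim (β≢α β≡α)
... | no  _   = refl

coeff-++ : ∀ {n} (p q : Poly n) α → coeff (p ++ q) α ≡ coeff p α ℤ.+ coeff q α
coeff-++ []            q α = sym (ℤP.+-identityˡ _)
coeff-++ ((c , β) ∷ p) q α with VP.≡-dec ℕ._≟_ β α
... | yes _ = trans (cong (λ z → c ℤ.+ z) (coeff-++ p q α)) (sym (ℤP.+-assoc c _ _))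
... | no  _ = coeff-++ p q α

*ₚ-∷ˡ : ∀ {n} t (p q : Poly n) → (t ∷ p) *ₚ q ≡ ((t ∷ []) *ₚ q) ++ (p *ₚ q)
*ₚ-∷ˡ t p q = cong (_++ (p *ₚ q)) (sym (LP.++-identityʳ _))

-- The ascription exposes the helper local to unitExp, which is out of scope here, so that
-- the second with can reduce it.
lookup-unitExp : ∀ {n} (i k : Fin n) → lookup (unitExp i) k ≡ (if does (k F.≟ i) then 1 else 0)
lookup-unitExp i k with lookup (unitExp i) k ≡ _ ∋ VP.lookup∘tabulate _ k
... | eq with k F.≟ i
...   | yes _ = eq
...   | no  _ = eq

≡-by-lookup : ∀ {A : Set} {n} {xs ys : Vec A n} → (∀ k → lookup xs k ≡ lookup ys k) → xs ≡ ys
≡-by-lookup {xs = xs} {ys} eq =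
  trans (sym (VP.tabulate∘lookup xs)) (trans (VP.tabulate-cong eq) (VP.tabulate∘lookup ys))

unitExp-suc : ∀ {n} (j : Fin n) → unitExp (suc j) ≡ 0 ∷ unitExp j
unitExp-suc j = ≡-by-lookup λ
  { zero    → refl
  ; (suc k) → trans (lookup-unitExp (suc j) (suc k)) (sym (lookup-unitExp j k)) }

unitExp-zero : ∀ {n} → unitExp {suc n} zero ≡ 1 ∷ replicate n 0
unitExp-zero = ≡-by-lookup λ
  { zero    → refl
  ; (suc k) → trans (lookup-unitExp zero (suc k)) (sym (VP.lookup-replicate k 0)) }

-- Splitting off the first variable

filter-map : ∀ {A B : Set} {P : B → Set} {Q : A → Set} (P? : Decidable P) (Q? : Decidable Q)
  (f : A → B) → (∀ x → does (P? (f x)) ≡ does (Q? x)) →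
  ∀ xs → filter P? (List.map f xs) ≡ List.map f (filter Q? xs)
filter-map P? Q? f agree []       = refl
filter-map P? Q? f agree (x ∷ xs) with does (P? (f x)) | does (Q? x) | agree x
... | true  | true  | refl = cong (f x ∷_) (filter-map P? Q? f agree xs)
... | false | false | refl = filter-map P? Q? f agree xs

filter-concatMap : ∀ {A B : Set} {P : B → Set} (P? : Decidable P) (f : A → List B) xs →
  filter P? (concatMap f xs) ≡ concatMap (filter P? ∘ f) xs
filter-concatMap P? f []       = refl
filter-concatMap P? f (x ∷ xs) =
  trans (LP.filter-++ P? (f x) (concatMap f xs)) (cong (filter P? (f x) ++_) (filter-concatMap P? f xs))

ordered? : ∀ {n} (p : Fin n × Fin n) → Dec (toℕ (proj₁ p) ℕ.< toℕ (proj₂ p))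
ordered? (i , j) = toℕ i <? toℕ j

row : ∀ {n} → Fin n → List (Fin n × Fin n)
row {n} i = List.map (i ,_) (allFin n)

zeroPairs : ∀ m → List (Fin (suc m) × Fin (suc m))
zeroPairs m = List.map (λ j → zero , suc j) (allFin m)

pairsLt-rows : ∀ n → pairsLt n ≡ concatMap (filter ordered? ∘ row) (allFin n)
pairsLt-rows n = filter-concatMap ordered? row (allFin n)

tabulate-suc : ∀ m → List.tabulate {n = m} suc ≡ List.map suc (allFin m)
tabulate-suc m = sym (LP.map-tabulate {n = m} (λ i → i) F.suc)

ordered-row-zero : ∀ m → filter ordered? (row {suc m} zero) ≡ zeroPairs m
ordered-row-zero m = trans (cong (filter ordered? ∘ List.map (zero ,_)) (tabulate-suc m)) (accepted (allFin m))
  where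
  accepted : (js : List (Fin m)) →
    filter ordered? (List.map (zero ,_) (List.map suc js)) ≡ List.map (λ j → zero , suc j) js
  accepted []       = refl
  accepted (j ∷ js) = cong ((zero , suc j) ∷_) (accepted js)

ordered-row-suc : ∀ {m} (i : Fin m) →
  filter ordered? (row (suc i)) ≡ List.map (Product.map suc suc) (filter ordered? (row i))
ordered-row-suc {m} i = begin
    filter ordered? (row (suc i))
  ≡⟨ cong (filter ordered? ∘ List.map (suc i ,_)) (tabulate-suc m) ⟩
    filter ordered? (List.map (suc i ,_) (List.map suc (allFin m)))
  ≡⟨ cong (filter ordered?) (sym (LP.map-∘ (allFin m))) ⟩
    filter ordered? (List.map (Product.map suc suc ∘ (i ,_)) (allFin m))
  ≡⟨ filter-map ordered? (ordered? ∘ (i ,_)) _ (λ _ → refl) (allFin m) ⟩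
    List.map (Product.map suc suc ∘ (i ,_)) (filter (ordered? ∘ (i ,_)) (allFin m))
  ≡⟨ LP.map-∘ _ ⟩
    List.map (Product.map suc suc) (List.map (i ,_) (filter (ordered? ∘ (i ,_)) (allFin m)))
  ≡⟨ cong (List.map _) (sym (filter-map ordered? (ordered? ∘ (i ,_)) _ (λ _ → refl) (allFin m))) ⟩
    List.map (Product.map suc suc) (filter ordered? (row i))
  ∎ where open ≡-Reasoning

pairsLt-suc : ∀ m →
  pairsLt (suc m) ≡ zeroPairs m ++ List.map (Product.map suc suc) (pairsLt m)
pairsLt-suc m = begin
    pairsLt (suc m)
  ≡⟨ pairsLt-rows (suc m) ⟩
    filter ordered? (row zero) ++ concatMap (filter ordered? ∘ row) (List.tabulate F.suc)
  ≡⟨ cong₂ _++_ (ordered-row-zero m) (cong (concatMap _) (tabulate-suc m)) ⟩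
    zeroPairs m ++ concatMap (filter ordered? ∘ row) (List.map suc (allFin m))
  ≡⟨ cong (zeroPairs m ++_) (LP.concatMap-map _ suc (allFin m)) ⟩
    zeroPairs m ++ concatMap (filter ordered? ∘ row ∘ suc) (allFin m)
  ≡⟨ cong (zeroPairs m ++_) (LP.concatMap-cong ordered-row-suc (allFin m)) ⟩
    zeroPairs m ++ concatMap (List.map (Product.map suc suc) ∘ filter ordered? ∘ row) (allFin m)
  ≡⟨ cong (zeroPairs m ++_) (sym (LP.map-concatMap _ _ (allFin m))) ⟩
    zeroPairs m ++ List.map (Product.map suc suc) (concatMap (filter ordered? ∘ row) (allFin m))
  ≡⟨ cong (λ ps → zeroPairs m ++ List.map (Product.map suc suc) ps) (sym (pairsLt-rows m)) ⟩
    zeroPairs m ++ List.map (Product.map suc suc) (pairsLt m)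
  ∎ where open ≡-Reasoning

lift : ∀ {m} → Poly m → Poly (suc m)
lift = List.map (Product.map₂ (0 ∷_))

lift-*ₚ : ∀ {m} (p q : Poly m) → lift (p *ₚ q) ≡ lift p *ₚ lift q
lift-*ₚ []            q = refl
lift-*ₚ ((c , α) ∷ p) q = begin
    lift (((c , α) ∷ p) *ₚ q)
  ≡⟨ cong lift (*ₚ-∷ˡ (c , α) p q) ⟩
    lift ((((c , α) ∷ []) *ₚ q) ++ (p *ₚ q))
  ≡⟨ LP.map-++ _ (((c , α) ∷ []) *ₚ q) (p *ₚ q) ⟩
    lift (((c , α) ∷ []) *ₚ q) ++ lift (p *ₚ q)
  ≡⟨ cong₂ _++_ (lift-monomial q) (lift-*ₚ p q) ⟩
    (((c , 0 ∷ α) ∷ []) *ₚ lift q) ++ (lift p *ₚ lift q)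
  ≡⟨ sym (*ₚ-∷ˡ (c , 0 ∷ α) (lift p) (lift q)) ⟩
    lift ((c , α) ∷ p) *ₚ lift q
  ∎ where
    open ≡-Reasoning
    lift-monomial : ∀ q → lift (((c , α) ∷ []) *ₚ q) ≡ ((c , 0 ∷ α) ∷ []) *ₚ lift q
    lift-monomial []            = refl
    lift-monomial ((d , β) ∷ q) = cong (_ ∷_) (lift-monomial q)

lift-productₚ : ∀ {m} (ps : List (Poly m)) → lift (productₚ ps) ≡ productₚ (List.map lift ps)
lift-productₚ []       = refl
lift-productₚ (p ∷ ps) = trans (lift-*ₚ p (productₚ ps)) (cong (lift p *ₚ_) (lift-productₚ ps))

lift-diffₚ : ∀ {m} (i j : Fin m) → lift (diffₚ i j) ≡ diffₚ (suc i) (suc j)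
lift-diffₚ i j = cong₂ (λ α β → (+ 1 , α) ∷ (-[1+ 0 ] , β) ∷ []) (sym (unitExp-suc i)) (sym (unitExp-suc j))

factor : ∀ {n} → Fin n × Fin n → Poly n
factor (i , j) = diffₚ i j

diffₚ₀ : ∀ {m} → Fin m → Poly (suc m)
diffₚ₀ j = diffₚ zero (suc j)

vandermonde-suc : ∀ m →
  vandermonde (suc m) ≡ foldr _*ₚ_ (lift (vandermonde m)) (List.map diffₚ₀ (allFin m))
vandermonde-suc m = begin
    productₚ (List.map factor (pairsLt (suc m)))
  ≡⟨ cong (productₚ ∘ List.map factor) (pairsLt-suc m) ⟩
    productₚ (List.map factor (zeroPairs m ++ List.map (Product.map suc suc) (pairsLt m)))
  ≡⟨ cong productₚ (LP.map-++ factor (zeroPairs m) _) ⟩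
    productₚ (List.map factor (zeroPairs m) ++ List.map factor (List.map (Product.map suc suc) (pairsLt m)))
  ≡⟨ LP.foldr-++ _*ₚ_ oneₚ (List.map factor (zeroPairs m)) _ ⟩
    foldr _*ₚ_ (productₚ (List.map factor (List.map (Product.map suc suc) (pairsLt m)))) (List.map factor (zeroPairs m))
  ≡⟨ cong₂ (foldr _*ₚ_) shifted-factors (sym (LP.map-∘ (allFin m))) ⟩
    foldr _*ₚ_ (lift (vandermonde m)) (List.map diffₚ₀ (allFin m))
  ∎ where
    open ≡-Reasoning
    shifted-factors : productₚ (List.map factor (List.map (Product.map suc suc) (pairsLt m))) ≡ lift (vandermonde m)
    shifted-factors = begin
        productₚ (List.map factor (List.map (Product.map suc suc) (pairsLt m)))
      ≡⟨ cong productₚ (sym (LP.map-∘ (pairsLt m))) ⟩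
        productₚ (List.map (factor ∘ Product.map suc suc) (pairsLt m))
      ≡⟨ cong productₚ (LP.map-cong (λ { (i , j) → sym (lift-diffₚ i j) }) (pairsLt m)) ⟩
        productₚ (List.map (lift ∘ factor) (pairsLt m))
      ≡⟨ cong productₚ (LP.map-∘ (pairsLt m)) ⟩
        productₚ (List.map lift (List.map factor (pairsLt m)))
      ≡⟨ sym (lift-productₚ (List.map factor (pairsLt m))) ⟩
        lift (vandermonde m)
      ∎

Deg₀≤ : ∀ {m} → ℕ → Poly (suc m) → Set
Deg₀≤ t p = All (λ term → Vec.head (proj₂ term) ≤ t) p

lift-Deg₀≤ : ∀ {m} (p : Poly m) → Deg₀≤ 0 (lift p)
lift-Deg₀≤ []      = []
lift-Deg₀≤ (_ ∷ p) = z≤n ∷ lift-Deg₀≤ p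

coeff-lift : ∀ {m} (p : Poly m) α → coeff (lift p) (0 ∷ α) ≡ coeff p α
coeff-lift []            α = refl
coeff-lift ((c , β) ∷ p) α with VP.≡-dec ℕ._≟_ β α
... | yes refl = cong (λ z → c ℤ.+ z) (coeff-lift p α)
... | no  _    = coeff-lift p α

zipWith-unitExp-zero : ∀ {m} b (β : Exp m) → zipWith ℕ._+_ (unitExp zero) (b ∷ β) ≡ suc b ∷ β
zipWith-unitExp-zero b β =
  trans (cong (λ u → zipWith ℕ._+_ u (b ∷ β)) unitExp-zero) (cong (suc b ∷_) (VP.zipWith-identityˡ ℕP.+-identityˡ β))

coeff-var₀*ₚ : ∀ {m} (r : Poly (suc m)) t α → coeff (var zero *ₚ r) (suc t ∷ α) ≡ coeff r (t ∷ α)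
coeff-var₀*ₚ []                 t α = refl
coeff-var₀*ₚ ((d , b ∷ β) ∷ r) t α with VP.≡-dec ℕ._≟_ (b ∷ β) (t ∷ α)
... | yes refl = trans (coeff-∷-≡ _ _ (zipWith-unitExp-zero t α))
                       (cong₂ ℤ._+_ (ℤP.*-identityˡ d) (coeff-var₀*ₚ r t α))
... | no  b∷β≢t∷α = trans (coeff-∷-≢ _ _ shifted≢) (coeff-var₀*ₚ r t α)
  where
  shifted≢ : zipWith ℕ._+_ (unitExp zero) (b ∷ β) ≢ suc t ∷ α
  shifted≢ eq with trans (sym (zipWith-unitExp-zero b β)) eq
  ... | refl = b∷β≢t∷α refl

Deg₀≤-var₀*ₚ : ∀ {m t} (r : Poly (suc m)) → Deg₀≤ t r → Deg₀≤ (suc t) (var zero *ₚ r)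
Deg₀≤-var₀*ₚ []                []          = []
Deg₀≤-var₀*ₚ ((d , b ∷ β) ∷ r) (b≤t ∷ r≤t) = s≤s b≤t ∷ Deg₀≤-var₀*ₚ r r≤t

coeff-x₀-free*ₚ : ∀ {m t} c (γ : Exp m) (r : Poly (suc m)) α → Deg₀≤ t r →
  coeff (((c , 0 ∷ γ) ∷ []) *ₚ r) (suc t ∷ α) ≡ + 0
coeff-x₀-free*ₚ c γ []                α []                  = refl
coeff-x₀-free*ₚ {t = t} c γ ((d , b ∷ β) ∷ r) α (b≤t ∷ r≤t) =
  trans (coeff-∷-≢ _ _ (λ eq → ℕP.1+n≰n (subst (_≤ t) (VP.∷-injectiveˡ eq) b≤t))) (coeff-x₀-free*ₚ c γ r α r≤t)

Deg₀≤-x₀-free*ₚ : ∀ {m t} c (γ : Exp m) (r : Poly (suc m)) → Deg₀≤ t r →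
  Deg₀≤ (suc t) (((c , 0 ∷ γ) ∷ []) *ₚ r)
Deg₀≤-x₀-free*ₚ c γ []                []          = []
Deg₀≤-x₀-free*ₚ c γ ((d , b ∷ β) ∷ r) (b≤t ∷ r≤t) = ℕP.m≤n⇒m≤1+n b≤t ∷ Deg₀≤-x₀-free*ₚ c γ r r≤t

diffₚ₀-*ₚ : ∀ {m} (j : Fin m) (r : Poly (suc m)) →
  diffₚ₀ j *ₚ r ≡ (var zero *ₚ r) ++ (((-[1+ 0 ] , 0 ∷ unitExp j) ∷ []) *ₚ r)
diffₚ₀-*ₚ j r = trans (cong (λ α → ((+ 1 , unitExp zero) ∷ (-[1+ 0 ] , α) ∷ []) *ₚ r) (unitExp-suc j))
                      (*ₚ-∷ˡ (+ 1 , unitExp zero) ((-[1+ 0 ] , 0 ∷ unitExp j) ∷ []) r)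

Deg₀≤-diffₚ₀-*ₚ : ∀ {m t} (j : Fin m) (r : Poly (suc m)) → Deg₀≤ t r → Deg₀≤ (suc t) (diffₚ₀ j *ₚ r)
Deg₀≤-diffₚ₀-*ₚ j r r≤t = subst (Deg₀≤ _) (sym (diffₚ₀-*ₚ j r))
  (AllP.++⁺ (Deg₀≤-var₀*ₚ r r≤t) (Deg₀≤-x₀-free*ₚ -[1+ 0 ] (unitExp j) r r≤t))

coeff-diffₚ₀-*ₚ : ∀ {m t} (j : Fin m) (r : Poly (suc m)) α → Deg₀≤ t r →
  coeff (diffₚ₀ j *ₚ r) (suc t ∷ α) ≡ coeff r (t ∷ α)
coeff-diffₚ₀-*ₚ {t = t} j r α r≤t = begin
    coeff (diffₚ₀ j *ₚ r) (suc t ∷ α)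
  ≡⟨ cong (λ p → coeff p (suc t ∷ α)) (diffₚ₀-*ₚ j r) ⟩
    coeff ((var zero *ₚ r) ++ (((-[1+ 0 ] , 0 ∷ unitExp j) ∷ []) *ₚ r)) (suc t ∷ α)
  ≡⟨ coeff-++ (var zero *ₚ r) _ _ ⟩
    coeff (var zero *ₚ r) (suc t ∷ α) ℤ.+ coeff (((-[1+ 0 ] , 0 ∷ unitExp j) ∷ []) *ₚ r) (suc t ∷ α)
  ≡⟨ cong₂ ℤ._+_ (coeff-var₀*ₚ r t α) (coeff-x₀-free*ₚ -[1+ 0 ] (unitExp j) r α r≤t) ⟩
    coeff r (t ∷ α) ℤ.+ + 0
  ≡⟨ ℤP.+-identityʳ _ ⟩
    coeff r (t ∷ α)
  ∎ where open ≡-Reasoning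

Deg₀≤-diffₚ₀-product : ∀ {m t} (js : List (Fin m)) (r : Poly (suc m)) → Deg₀≤ t r →
  Deg₀≤ (length js ℕ.+ t) (foldr _*ₚ_ r (List.map diffₚ₀ js))
Deg₀≤-diffₚ₀-product []       r r≤t = r≤t
Deg₀≤-diffₚ₀-product (j ∷ js) r r≤t = Deg₀≤-diffₚ₀-*ₚ j _ (Deg₀≤-diffₚ₀-product js r r≤t)

coeff-diffₚ₀-product : ∀ {m t} (js : List (Fin m)) (r : Poly (suc m)) α → Deg₀≤ t r →
  coeff (foldr _*ₚ_ r (List.map diffₚ₀ js)) (length js ℕ.+ t ∷ α) ≡ coeff r (t ∷ α)
coeff-diffₚ₀-product []       r α r≤t = refl
coeff-diffₚ₀-product (j ∷ js) r α r≤t =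
  trans (coeff-diffₚ₀-*ₚ j _ α (Deg₀≤-diffₚ₀-product js r r≤t)) (coeff-diffₚ₀-product js r α r≤t)

coeff-vandermonde-suc : ∀ m α → coeff (vandermonde (suc m)) (m ∷ α) ≡ coeff (vandermonde m) α
coeff-vandermonde-suc m α = begin
    coeff (vandermonde (suc m)) (m ∷ α)
  ≡⟨ cong₂ (λ p k → coeff p (k ∷ α)) (vandermonde-suc m) m≡length ⟩
    coeff (foldr _*ₚ_ (lift (vandermonde m)) (List.map diffₚ₀ (allFin m))) (length (allFin m) ℕ.+ 0 ∷ α)
  ≡⟨ coeff-diffₚ₀-product (allFin m) (lift (vandermonde m)) α (lift-Deg₀≤ (vandermonde m)) ⟩
    coeff (lift (vandermonde m)) (0 ∷ α)
  ≡⟨ coeff-lift (vandermonde m) α ⟩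
    coeff (vandermonde m) α
  ∎ where
    open ≡-Reasoning
    m≡length : m ≡ length (allFin m) ℕ.+ 0
    m≡length = sym (trans (ℕP.+-identityʳ _) (LP.length-tabulate (λ i → i)))

-- Lattice points in the Newton polytope of a homogeneous polynomial

ℕtoℚ≡mkℚ : ∀ n → ℕtoℚ n ≡ mkℚ (+ n) 0 (Coprimality.sym (Coprimality.1-coprimeTo n))
ℕtoℚ≡mkℚ n = ℚP.normalize-coprime (Coprimality.sym (Coprimality.1-coprimeTo n))

ℤtoℚ-neg≡mkℚ : ∀ n → ℤtoℚ -[1+ n ] ≡ mkℚ -[1+ n ] 0 (Coprimality.sym (Coprimality.1-coprimeTo (suc n)))
ℤtoℚ-neg≡mkℚ n = cong ℚ.-_ (ℕtoℚ≡mkℚ (suc n))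

↥-ℤtoℚ : ∀ z → ↥ (ℤtoℚ z) ≡ z
↥-ℤtoℚ (+ n)    = cong ↥_ (ℕtoℚ≡mkℚ n)
↥-ℤtoℚ -[1+ n ] = cong ↥_ (ℤtoℚ-neg≡mkℚ n)

ℤtoℚ-injective : ∀ {a b} → ℤtoℚ a ≡ ℤtoℚ b → a ≡ b
ℤtoℚ-injective {a} {b} eq = trans (sym (↥-ℤtoℚ a)) (trans (cong ↥_ eq) (↥-ℤtoℚ b))

ℕtoℚ-injective : ∀ {a b} → ℕtoℚ a ≡ ℕtoℚ b → a ≡ b
ℕtoℚ-injective = ℤP.+-injective ∘ ℤtoℚ-injective

ℕtoℚ-+ : ∀ a b → ℕtoℚ (a ℕ.+ b) ≡ ℕtoℚ a ℚ.+ ℕtoℚ b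
ℕtoℚ-+ a b = sym (trans (cong₂ ℚ._+_ (ℕtoℚ≡mkℚ a) (ℕtoℚ≡mkℚ b))
  (cong (ℚ._/ 1) (cong₂ ℤ._+_ (ℤP.*-identityʳ (+ a)) (ℤP.*-identityʳ (+ b)))))

ℕtoℚ-nonneg : ∀ a → 0ℚ ℚ.≤ ℕtoℚ a
ℕtoℚ-nonneg a = ℚP.nonNegative⁻¹ _ {{ℚP.normalize-nonNeg a 1}}

ℤtoℚ-nonneg⇒ℕ : ∀ z → 0ℚ ℚ.≤ ℤtoℚ z → ∃[ k ] z ≡ + k
ℤtoℚ-nonneg⇒ℕ (+ k)    _  = k , refl
ℤtoℚ-nonneg⇒ℕ -[1+ m ] z≥0 with subst (0ℚ ℚ.≤_) (ℤtoℚ-neg≡mkℚ m) z≥0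
... | ℚ.*≤* ()

*-nonneg : ∀ {p q} → 0ℚ ℚ.≤ p → 0ℚ ℚ.≤ q → 0ℚ ℚ.≤ p ℚ.* q
*-nonneg {p} {q} p≥0 q≥0 = ℚP.nonNegative⁻¹ _
  {{ℚP.nonNeg*nonNeg⇒nonNeg p {{ℚ.nonNegative p≥0}} q {{ℚ.nonNegative q≥0}}}}

+-nonneg : ∀ {p q} → 0ℚ ℚ.≤ p → 0ℚ ℚ.≤ q → 0ℚ ℚ.≤ p ℚ.+ q
+-nonneg = ℚP.+-mono-≤

scaled-nonneg : ∀ {n w} → 0ℚ ℚ.≤ w → (α : Exp n) → VAll.All (0ℚ ℚ.≤_) (Vec.map (λ a → w ℚ.* ℕtoℚ a) α)
scaled-nonneg w≥0 []      = VAll.[]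
scaled-nonneg w≥0 (a ∷ α) = *-nonneg w≥0 (ℕtoℚ-nonneg a) VAll.∷ scaled-nonneg w≥0 α

sumℚ : ∀ {n} → Vec ℚ n → ℚ
sumℚ = Vec.foldr _ ℚ._+_ 0ℚ

sumℚ-replicate-0 : ∀ n → sumℚ (replicate n 0ℚ) ≡ 0ℚ
sumℚ-replicate-0 zero    = refl
sumℚ-replicate-0 (suc n) = trans (ℚP.+-identityˡ _) (sumℚ-replicate-0 n)

sumℚ-zipWith-+ : ∀ {n} (u v : Vec ℚ n) → sumℚ (zipWith ℚ._+_ u v) ≡ sumℚ u ℚ.+ sumℚ v
sumℚ-zipWith-+ []      []      = refl
sumℚ-zipWith-+ (x ∷ u) (y ∷ v) =
  trans (cong ((x ℚ.+ y) ℚ.+_) (sumℚ-zipWith-+ u v)) (+-interchange x y (sumℚ u) (sumℚ v))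
  where
  open import Algebra.Properties.CommutativeSemigroup
    (CommutativeMonoid.commutativeSemigroup ℚP.+-0-commutativeMonoid) renaming (interchange to +-interchange)

sumℚ-scaled : ∀ {n} w (α : Exp n) → sumℚ (Vec.map (λ a → w ℚ.* ℕtoℚ a) α) ≡ w ℚ.* ℕtoℚ (Vec.sum α)
sumℚ-scaled w []      = sym (ℚP.*-zeroʳ w)
sumℚ-scaled w (a ∷ α) = begin
    w ℚ.* ℕtoℚ a ℚ.+ sumℚ (Vec.map (λ a → w ℚ.* ℕtoℚ a) α)
  ≡⟨ cong (w ℚ.* ℕtoℚ a ℚ.+_) (sumℚ-scaled w α) ⟩
    w ℚ.* ℕtoℚ a ℚ.+ w ℚ.* ℕtoℚ (Vec.sum α)
  ≡⟨ sym (ℚP.*-distribˡ-+ w (ℕtoℚ a) _) ⟩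
    w ℚ.* (ℕtoℚ a ℚ.+ ℕtoℚ (Vec.sum α))
  ≡⟨ cong (w ℚ.*_) (sym (ℕtoℚ-+ a (Vec.sum α))) ⟩
    w ℚ.* ℕtoℚ (a ℕ.+ Vec.sum α)
  ∎ where open ≡-Reasoning

sumℚ-ℕtoℚ : ∀ {n} (α : Exp n) → sumℚ (Vec.map ℕtoℚ α) ≡ ℕtoℚ (Vec.sum α)
sumℚ-ℕtoℚ []      = refl
sumℚ-ℕtoℚ (a ∷ α) = trans (cong (ℕtoℚ a ℚ.+_) (sumℚ-ℕtoℚ α)) (sym (ℕtoℚ-+ a (Vec.sum α)))

addScaled : ∀ {n} → ℚ × Exp n → Vec ℚ n → Vec ℚ n
addScaled (w , α) s = zipWith ℚ._+_ (Vec.map (λ a → w ℚ.* ℕtoℚ a) α) s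

addWeight : ∀ {n} → ℚ × Exp n → ℚ → ℚ
addWeight (w , _) s = w ℚ.+ s

combination : ∀ {n} → List (ℚ × Exp n) → Vec ℚ n
combination {n} = foldr addScaled (replicate n 0ℚ)

totalWeight : ∀ {n} → List (ℚ × Exp n) → ℚ
totalWeight = foldr addWeight 0ℚ

Homogeneous : ∀ {n} → ℕ → Poly n → Set
Homogeneous d p = All (λ term → Vec.sum (proj₂ term) ≡ d) p

InSupport-homogeneous : ∀ {n d} (p : Poly n) {α} → Homogeneous d p → InSupport p α → Vec.sum α ≡ d
InSupport-homogeneous []            []             α∈p = ⊥-elim (α∈p refl)
InSupport-homogeneous ((c , β) ∷ p) {α} (β-deg ∷ hom) α∈p with VP.≡-dec ℕ._≟_ β α
... | yes refl = β-deg
... | no  _    = InSupport-homogeneous p hom α∈p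

combination-homogeneous : ∀ {n d} (ws : List (ℚ × Exp n)) →
  All (λ { (w , α) → 0ℚ ℚ.≤ w × Vec.sum α ≡ d }) ws →
  VAll.All (0ℚ ℚ.≤_) (combination ws) × sumℚ (combination ws) ≡ ℕtoℚ d ℚ.* totalWeight ws
combination-homogeneous {n} {d} [] [] =
  VAllP.lookup⁻ (λ k → subst (0ℚ ℚ.≤_) (sym (VP.lookup-replicate k 0ℚ)) ℚP.≤-refl) ,
  trans (sumℚ-replicate-0 n) (sym (ℚP.*-zeroʳ (ℕtoℚ d)))
combination-homogeneous {d = d} ((w , α) ∷ ws) ((w≥0 , refl) ∷ valid) =
  VAll.zipWith +-nonneg (scaled-nonneg w≥0 α) nonneg ,
  (begin
    sumℚ (addScaled (w , α) (combination ws))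
  ≡⟨ sumℚ-zipWith-+ (Vec.map (λ a → w ℚ.* ℕtoℚ a) α) (combination ws) ⟩
    sumℚ (Vec.map (λ a → w ℚ.* ℕtoℚ a) α) ℚ.+ sumℚ (combination ws)
  ≡⟨ cong₂ ℚ._+_ (trans (sumℚ-scaled w α) (ℚP.*-comm w _)) sum≡ ⟩
    ℕtoℚ d ℚ.* w ℚ.+ ℕtoℚ d ℚ.* totalWeight ws
  ≡⟨ sym (ℚP.*-distribˡ-+ (ℕtoℚ d) w (totalWeight ws)) ⟩
    ℕtoℚ d ℚ.* totalWeight ((w , α) ∷ ws)
  ∎)
  where
  open ≡-Reasoning
  nonneg : VAll.All (0ℚ ℚ.≤_) (combination ws)
  nonneg = proj₁ (combination-homogeneous ws valid)
  sum≡ : sumℚ (combination ws) ≡ ℕtoℚ d ℚ.* totalWeight ws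
  sum≡ = proj₂ (combination-homogeneous ws valid)

nonneg-lattice-point : ∀ {n} (β : Vec ℤ n) → VAll.All (0ℚ ℚ.≤_) (Vec.map ℤtoℚ β) → ∃[ α ] Vec.map +_ α ≡ β
nonneg-lattice-point []      VAll.[]              = [] , refl
nonneg-lattice-point (b ∷ β) (b≥0 VAll.∷ β≥0) with ℤtoℚ-nonneg⇒ℕ b b≥0 | nonneg-lattice-point β β≥0
... | a , refl | α , refl = a ∷ α , refl

lattice-point-homogeneous : ∀ {n d} {p : Poly n} → Homogeneous d p → (β : Vec ℤ n) →
  InNewtonPolytope p (Vec.map ℤtoℚ β) → ∃[ α ] (Vec.map +_ α ≡ β × Vec.sum α ≡ d)
lattice-point-homogeneous {d = d} {p} hom β (ws , valid , weight≡1 , ws≡β)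
  with combination-homogeneous ws (All.map (Product.map₂ (InSupport-homogeneous p hom)) valid)
... | nonneg , sum≡ with nonneg-lattice-point β (subst (VAll.All (0ℚ ℚ.≤_)) ws≡β nonneg)
... | α , refl = α , refl , ℕtoℚ-injective (begin
    ℕtoℚ (Vec.sum α)                    ≡⟨ sym (sumℚ-ℕtoℚ α) ⟩
    sumℚ (Vec.map ℕtoℚ α)               ≡⟨ cong sumℚ (VP.map-∘ ℤtoℚ +_ α) ⟩
    sumℚ (Vec.map ℤtoℚ (Vec.map +_ α)) ≡⟨ cong sumℚ (sym ws≡β) ⟩
    sumℚ (combination ws)               ≡⟨ sum≡ ⟩
    ℕtoℚ d ℚ.* totalWeight ws           ≡⟨ cong (ℕtoℚ d ℚ.*_) weight≡1 ⟩
    ℕtoℚ d ℚ.* 1ℚ                       ≡⟨ ℚP.*-identityʳ _ ⟩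
    ℕtoℚ d                              ∎)
  where open ≡-Reasoning

homogeneous-saturated : ∀ {n d} {p : Poly n} → Homogeneous d p →
  (∀ α → Vec.sum α ≡ d → InSupport p α) → SaturatedNewton p
homogeneous-saturated hom full β β∈NP with lattice-point-homogeneous hom β β∈NP
... | α , α≡β , deg = α , α≡β , full α deg

-- The Vandermonde polynomial

vandermonde-saturated : ∀ n → n ≤ 2 → SaturatedNewton (vandermonde n)
vandermonde-saturated 0 _ = homogeneous-saturated {p = vandermonde 0} (refl ∷ []) λ { [] refl () }
vandermonde-saturated 1 _ = homogeneous-saturated {p = vandermonde 1} (refl ∷ []) λ
  { (zero ∷ []) refl ()
  ; (suc _ ∷ []) () }
vandermonde-saturated 2 _ = homogeneous-saturated {p = vandermonde 2} (refl ∷ refl ∷ []) λ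
  { (zero ∷ zero ∷ []) ()
  ; (zero ∷ suc zero ∷ []) refl ()
  ; (zero ∷ suc (suc _) ∷ []) ()
  ; (suc zero ∷ zero ∷ []) refl ()
  ; (suc zero ∷ suc _ ∷ []) ()
  ; (suc (suc _) ∷ _ ∷ []) () }
vandermonde-saturated (suc (suc (suc _))) (s≤s (s≤s ()))

map-+-injective : ∀ {n} {α β : Exp n} → Vec.map +_ α ≡ Vec.map +_ β → α ≡ β
map-+-injective {α = []}    {[]}    _  = refl
map-+-injective {α = a ∷ α} {b ∷ β} eq =
  cong₂ _∷_ (ℤP.+-injective (VP.∷-injectiveˡ eq)) (map-+-injective (VP.∷-injectiveʳ eq))

unsaturated : ∀ {n} (p : Poly n) (β : Exp n) →
  InNewtonPolytope p (Vec.map ℤtoℚ (Vec.map +_ β)) → coeff p β ≡ + 0 → ¬ SaturatedNewton p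
unsaturated p β β∈NP β∉p sat with sat (Vec.map +_ β) β∈NP
... | α , α≡β , α∈p = α∈p (trans (cong (coeff p) (map-+-injective α≡β)) β∉p)

staircase : ∀ k → Exp 3 → Exp (3 ℕ.+ k)
staircase zero    γ = γ
staircase (suc k) γ = 3 ℕ.+ k ∷ staircase k γ

coeff-vandermonde-staircase : ∀ k γ → coeff (vandermonde (3 ℕ.+ k)) (staircase k γ) ≡ coeff (vandermonde 3) γ
coeff-vandermonde-staircase zero    γ = refl
coeff-vandermonde-staircase (suc k) γ =
  trans (coeff-vandermonde-suc (3 ℕ.+ k) (staircase k γ)) (coeff-vandermonde-staircase k γ)

InSupport-staircase : ∀ k {γ} → InSupport (vandermonde 3) γ → InSupport (vandermonde (3 ℕ.+ k)) (staircase k γ)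
InSupport-staircase k {γ} γ∈V₃ eq = γ∈V₃ (trans (sym (coeff-vandermonde-staircase k γ)) eq)

⅓ : ℚ
⅓ = + 1 ℚ./ 3

⅓-nonneg : 0ℚ ℚ.≤ ⅓
⅓-nonneg = ℚP.nonNegative⁻¹ _ {{ℚP.normalize-nonNeg 1 3}}

thirds-sum : ∀ x → ⅓ ℚ.* x ℚ.+ (⅓ ℚ.* x ℚ.+ (⅓ ℚ.* x ℚ.+ 0ℚ)) ≡ x
thirds-sum x = begin
    ⅓ ℚ.* x ℚ.+ (⅓ ℚ.* x ℚ.+ (⅓ ℚ.* x ℚ.+ 0ℚ))
  ≡⟨ cong (λ z → ⅓ ℚ.* x ℚ.+ (⅓ ℚ.* x ℚ.+ z)) (ℚP.+-identityʳ _) ⟩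
    ⅓ ℚ.* x ℚ.+ (⅓ ℚ.* x ℚ.+ ⅓ ℚ.* x)
  ≡⟨ cong (⅓ ℚ.* x ℚ.+_) (sym (ℚP.*-distribʳ-+ x ⅓ ⅓)) ⟩
    ⅓ ℚ.* x ℚ.+ (⅓ ℚ.+ ⅓) ℚ.* x
  ≡⟨ sym (ℚP.*-distribʳ-+ x ⅓ (⅓ ℚ.+ ⅓)) ⟩
    (⅓ ℚ.+ (⅓ ℚ.+ ⅓)) ℚ.* x
  ≡⟨ ℚP.*-identityˡ x ⟩
    x
  ∎ where open ≡-Reasoning

barycentre : ∀ k → List (ℚ × Exp (3 ℕ.+ k))
barycentre k = (⅓ , staircase k (2 ∷ 1 ∷ 0 ∷ [])) ∷ (⅓ , staircase k (0 ∷ 2 ∷ 1 ∷ []))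
             ∷ (⅓ , staircase k (1 ∷ 0 ∷ 2 ∷ [])) ∷ []

combination-barycentre : ∀ k → combination (barycentre k) ≡ Vec.map ℤtoℚ (Vec.map +_ (staircase k (1 ∷ 1 ∷ 1 ∷ [])))
combination-barycentre zero    = refl
combination-barycentre (suc k) = cong₂ _∷_ (thirds-sum (ℕtoℚ (3 ℕ.+ k))) (combination-barycentre k)

vandermonde-unsaturated : ∀ k → ¬ SaturatedNewton (vandermonde (3 ℕ.+ k))
vandermonde-unsaturated k = unsaturated (vandermonde (3 ℕ.+ k)) (staircase k (1 ∷ 1 ∷ 1 ∷ []))
  (barycentre k , valid , refl , combination-barycentre k) (coeff-vandermonde-staircase k _)
  where
  valid : All (λ { (w , α) → 0ℚ ℚ.≤ w × InSupport (vandermonde (3 ℕ.+ k)) α }) (barycentre k)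
  valid = (⅓-nonneg , InSupport-staircase k (λ ())) ∷ (⅓-nonneg , InSupport-staircase k (λ ()))
        ∷ (⅓-nonneg , InSupport-staircase k (λ ())) ∷ []

proposition2p22 : (n : ℕ) → SaturatedNewton (vandermonde n) ⇔ (n ≤ 2)
proposition2p22 n = mk⇔ (bounded n) (vandermonde-saturated n)
  where
  bounded : ∀ n → SaturatedNewton (vandermonde n) → n ≤ 2
  bounded 0 _ = z≤n
  bounded 1 _ = s≤s z≤n
  bounded 2 _ = s≤s (s≤s z≤n)
  bounded (suc (suc (suc k))) saturated = ⊥-elim (vandermonde-unsaturated k saturated)
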